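{- The fragment $\mathcal{H}^c$ is reducible to $\mathcal{H}^c_{\infty,2}$.
   Context: Clauses and fragments. - Clauses are function-free second-order Horn clauses: a head (at most one positive literal) and a finite body of negative literals. Each literal is a predicate variable of arity in $\mathbb{N}^*$ applied to term variables. - The body size $|C|$ is the number of body literals. - A clause is connected if its literals cannot be partitioned into two non-empty sets with disjoint sets of variables. $\mathcal{H}^c$ is the set of all connected clauses. - $\mathcal{F}_{a,b}$ denotes the clauses of $\mathcal{F}$ with all literal arities at most $a$ and body size at most $b$; $\infty$ means no bound. - Fragments are considered modulo variable renaming and contain only the most general clauses up to variable unification; inferences are taken modulo variable unification. SLD-resolution. - Substitutions map term variables to term variables and predicate variables to predicate variables of the same arity. - An SLD-resolution inference $C_1,C_2\vdash C$ is binary resolution without factoring: a body literal of one premise is unified by a most general unifier with the head of the other, and the resolvent consists of the remaining literals with the unifier applied. Reducibility. A fragment $\mathcal{F}$ is reducible to $\mathcal{F}_{\infty,b}$ if, for every $C\in\mathcal{F}$ with $b<|C|$, there exists $b'<|C|$ such that $C$ is the resolvent of an SLD-inference whose premises lie in $\mathcal{F}_{\infty,b'}$. -}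

module Defs where

open import Data.Nat using (ℕ; suc; _≤_; _<_)
open import Data.Bool using (Bool; true; false)
open import Data.Fin using (Fin)
open import Data.Maybe using (Maybe; just; nothing)
open import Data.Vec using (Vec; toList)
open import Data.List using (List; []; _∷_; _++_; length; lookup; removeAt; concatMap)
import Data.Maybe as M
import Data.Vec as V
import Data.List as L
open import Data.List.Membership.Propositional using (_∈_)
open import Data.List.Relation.Binary.Permutation.Propositional using (_↭_)
open import Data.Product using (Σ; ∃; _×_; _,_)
open import Data.Empty using (⊥)
open import Relation.Nullary using (¬_)
open import Relation.Binary.PropositionalEquality using (_≡_)

-- A predicate variable is a name
-- (a natural number) together with its arity; arities are positive,
-- so a literal of arity (suc ar) carries a vector of suc ar term variables.

record Lit : Set where
  constructor lit
  field
    ar   : ℕ              -- the arity of the predicate variable is suc ar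
    pv   : ℕ
    args : Vec ℕ (suc ar)
open Lit public

record Clause : Set where
  constructor _⇐_
  field
    head : Maybe Lit
    body : List Lit
open Clause public

∣_∣ : Clause → ℕ
∣ C ∣ = length (body C)

lits : Clause → List Lit
lits C = M.maybe (λ h → h ∷ body C) (body C) (head C)

tvarsL : Lit → List ℕ
tvarsL l = toList (args l)

tvars : Clause → List ℕ
tvars C = concatMap tvarsL (lits C)

pvars : Clause → List (ℕ × ℕ)
pvars C = L.map (λ l → (pv l , ar l)) (lits C)

Disconnecting : List Lit → Set
Disconnecting ls =
  Σ (Fin (length ls) → Bool) λ f →
    (∃ λ i → f i ≡ true) × (∃ λ j → f j ≡ false) ×
    (∀ i j → f i ≡ true → f j ≡ false →
       ∀ x → x ∈ tvarsL (lookup ls i) → x ∈ tvarsL (lookup ls j) → ⊥)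

Connected : Clause → Set
Connected C = ¬ Disconnecting (lits C)

-- Substitutions: term variables to term variables, predicate variables
-- to predicate variables of the same arity (arity is preserved by
-- construction: the predicate part is indexed by the arity).

record Subst : Set where
  constructor sub
  field
    tσ : ℕ → ℕ
    pσ : ℕ → ℕ → ℕ   -- pσ ar p : new name of predicate variable p of arity suc ar
open Subst public

substL : Subst → Lit → Lit
substL σ (lit a p xs) = lit a (pσ σ a p) (V.map (tσ σ) xs)

substC : Subst → Clause → Clause
substC σ (h ⇐ b) = M.map (substL σ) h ⇐ L.map (substL σ) b

_∘ˢ_ : Subst → Subst → Subst
ρ ∘ˢ σ = sub (λ x → tσ ρ (tσ σ x)) (λ a p → pσ ρ a (pσ σ a p))

_≗ˢ_ : Subst → Subst → Set
σ ≗ˢ τ = (∀ x → tσ σ x ≡ tσ τ x) × (∀ a p → pσ σ a p ≡ pσ τ a p)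

Unifier : Subst → Lit → Lit → Set
Unifier σ l m = substL σ l ≡ substL σ m

MGU : Subst → Lit → Lit → Set
MGU σ l m = Unifier σ l m × (∀ τ → Unifier τ l m → ∃ λ ρ → τ ≗ˢ (ρ ∘ˢ σ))

Apart : Clause → Clause → Set
Apart C D = (∀ x → x ∈ tvars C → x ∈ tvars D → ⊥) ×
            (∀ p → p ∈ pvars C → p ∈ pvars D → ⊥)

-- Clause equality modulo the order of body literals (bodies are multisets).
_≈C_ : Clause → Clause → Set
C ≈C D = (head C ≡ head D) × (body C ↭ body D)

-- R is the resolvent of an SLD-inference (binary resolution without
-- factoring) with premises C₁ (body literal i resolved) and C₂ (head).
SLDResolvent : Clause → Clause → Clause → Set
SLDResolvent C₁ C₂ R =
  Apart C₁ C₂ ×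
  Σ (Fin (length (body C₁))) λ i → Σ Lit λ h → Σ Subst λ σ →
    (head C₂ ≡ just h) ×
    MGU σ (lookup (body C₁) i) h ×
    (R ≡ substC σ (head C₁ ⇐ (removeAt (body C₁) i ++ body C₂)))

-- C₁ , C₂ ⊢ C, inferences taken modulo variable unification (and hence
-- modulo renaming): C is obtained from the resolvent by a substitution.
SLDInfers : Clause → Clause → Clause → Set
SLDInfers C₁ C₂ C =
  Σ Clause λ R → SLDResolvent C₁ C₂ R × ∃ λ θ → substC θ R ≈C C

-- Fragments are predicates on clauses; F_{∞,b} = clauses of F with body ≤ b.

Fragment : Set₁
Fragment = Clause → Set

_∞,_ : Fragment → ℕ → Fragment
(F ∞, b) C = F C × ∣ C ∣ ≤ b

ReducibleTo : Fragment → ℕ → Set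
ReducibleTo F b =
  ∀ C → F C → b < ∣ C ∣ →
    ∃ λ b' → b' < ∣ C ∣ ×
      Σ Clause λ C₁ → Σ Clause λ C₂ →
        (F ∞, b') C₁ × (F ∞, b') C₂ ×
        SLDInfers C₁ C₂ C

Hc : Fragment
Hc = Connected

-- A clause of body size at least 3 is split into a two-literal part and the rest, glued by a
-- fresh "hub" literal whose arguments are all term variables of the clause.  The hub shares a
-- variable with every literal (arities are positive), so both premises are connected whether or
-- not the clause is; resolving the hub of the first premise against a renamed-apart copy of the
-- hub, heading the second, restores the clause up to renaming.
module Submission where

open import Defs
open import Function using (_∘_; id)
open import Data.Nat
open import Data.Nat.Properties
open import Data.Bool using (true; false)
open import Data.Fin using (Fin; zero; suc; toℕ; fromℕ<)
open import Data.Fin.Properties using (toℕ-fromℕ<; toℕ<n)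
open import Data.Maybe as Maybe using (Maybe; just; nothing)
open import Data.Maybe.Relation.Unary.All as MaybeAll using (just; nothing)
open import Data.Vec as Vec using (Vec; _∷_; []; tabulate; toList)
open import Data.Vec.Properties using (map-∘; toList-map; tabulate-∘; tabulate-cong; lookup∘tabulate)
open import Data.Vec.Membership.Propositional.Properties using (∈-tabulate⁺; ∈-toList⁺)
import Data.Vec.Relation.Unary.All.Properties as VecAll
open import Data.List as List using (List; []; _∷_; length; lookup; concatMap)
open import Data.List.Properties using (length-map)
open import Data.List.Relation.Unary.All as All using (All; []; _∷_)
open import Data.List.Relation.Unary.All.Properties using (map⁺; map⁻; concat⁺; concat⁻)
open import Data.List.Relation.Unary.Any using (here; there; index)
open import Data.List.Relation.Unary.Any.Properties using (lookup-index)
open import Data.List.Membership.Propositional using (_∈_)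
open import Data.List.Membership.Propositional.Properties using (∈-lookup; ∈-map⁺)
open import Data.List.Relation.Binary.Permutation.Propositional using (↭-reflexive)
open import Data.List.Extrema.Nat using (max; xs≤max)
open import Data.Product using (Σ; ∃; ∃₂; _×_; _,_; proj₁; proj₂)
open import Data.Empty using (⊥-elim)
open import Relation.Nullary using (¬_; yes; no)
open import Relation.Binary.PropositionalEquality

SharesVar : Lit → Lit → Set
SharesVar l l′ = ∃ λ x → x ∈ tvarsL l × x ∈ tvarsL l′

SharesVar-refl : ∀ l → SharesVar l l
SharesVar-refl (lit _ _ (x ∷ _)) = x , here refl , here refl

SharesVar-substL : ∀ σ l {l′} → SharesVar l l′ → SharesVar (substL σ l) (substL σ l′)
SharesVar-substL σ (lit _ _ xs) {lit _ _ ys} (x , x∈l , x∈l′) =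
  tσ σ x , ∈-renamed xs x∈l , ∈-renamed ys x∈l′
  where
  ∈-renamed : ∀ {n} (zs : Vec ℕ n) → x ∈ toList zs → tσ σ x ∈ toList (Vec.map (tσ σ) zs)
  ∈-renamed zs x∈ = subst (tσ σ x ∈_) (sym (toList-map (tσ σ) zs)) (∈-map⁺ (tσ σ) x∈)

hub⇒¬Disconnecting : ∀ ls (k : Fin (length ls)) →
  (∀ j → SharesVar (lookup ls k) (lookup ls j)) → ¬ Disconnecting ls
hub⇒¬Disconnecting ls k shares (f , (i , fi) , (j , fj) , disjoint) with f k in fk
... | true  = let x , x∈k , x∈j = shares j in disjoint k j fk fj x x∈k x∈j
... | false = let x , x∈k , x∈i = shares i in disjoint i k fi fk x x∈i x∈k

shared⇒¬Disconnecting : ∀ {h} ls → h ∈ ls → All (SharesVar h) ls → ¬ Disconnecting ls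
shared⇒¬Disconnecting ls h∈ls shared = hub⇒¬Disconnecting ls (index h∈ls) λ j →
  subst (λ l → SharesVar l (lookup ls j)) (lookup-index h∈ls) (All.lookup shared (∈-lookup j))

module _ {Q : Lit → Set} where

  All-lits⁺ : ∀ C → MaybeAll.All Q (head C) → All Q (body C) → All Q (lits C)
  All-lits⁺ (nothing ⇐ _) nothing  qs = qs
  All-lits⁺ (just _ ⇐ _)  (just q) qs = q ∷ qs

  All-lits⁻ : ∀ C → All Q (lits C) → MaybeAll.All Q (head C) × All Q (body C)
  All-lits⁻ (nothing ⇐ _) qs       = nothing , qs
  All-lits⁻ (just _ ⇐ _)  (q ∷ qs) = just q , qs

∈-body⇒∈-lits : ∀ {l} C → l ∈ body C → l ∈ lits C
∈-body⇒∈-lits (nothing ⇐ _) l∈ = l∈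
∈-body⇒∈-lits (just _ ⇐ _)  l∈ = there l∈

module _ {Q : ℕ → Set} where

  All-tvars⁺ : ∀ ls → All (All Q ∘ tvarsL) ls → All Q (concatMap tvarsL ls)
  All-tvars⁺ _ = concat⁺ ∘ map⁺

  All-tvars⁻ : ∀ ls → All Q (concatMap tvarsL ls) → All (All Q ∘ tvarsL) ls
  All-tvars⁻ _ = map⁻ ∘ concat⁻

separated⇒Apart : ∀ {K P} C D →
  All (_≤ K) (tvars C) → All (K <_) (tvars D) →
  All ((_≤ P) ∘ proj₁) (pvars C) → All ((P <_) ∘ proj₁) (pvars D) → Apart C D
separated⇒Apart C D varsC varsD namesC namesD =
  (λ x x∈C x∈D → <⇒≱ (All.lookup varsD x∈D) (All.lookup varsC x∈C)) ,
  (λ q q∈C q∈D → <⇒≱ (All.lookup namesD q∈D) (All.lookup namesC q∈C))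

lit-injectiveʳ : ∀ {a p q} {xs ys : Vec ℕ (suc a)} → lit a p xs ≡ lit a q ys → xs ≡ ys
lit-injectiveʳ refl = refl

substL-∘ : ∀ ρ σ l → substL ρ (substL σ l) ≡ substL (ρ ∘ˢ σ) l
substL-∘ ρ σ (lit a p xs) = cong (lit a _) (sym (map-∘ (tσ ρ) (tσ σ) xs))

substL-fixes : ∀ σ l → All (λ x → tσ σ x ≡ x) (tvarsL l) → pσ σ (ar l) (pv l) ≡ pv l →
               substL σ l ≡ l
substL-fixes σ (lit a p xs) fixesVars fixesName = cong₂ (lit a) fixesName (map-fixes xs fixesVars)
  where
  map-fixes : ∀ {n} (ys : Vec ℕ n) → All (λ y → tσ σ y ≡ y) (toList ys) → Vec.map (tσ σ) ys ≡ ys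
  map-fixes []       []       = refl
  map-fixes (_ ∷ ys) (e ∷ es) = cong₂ _∷_ e (map-fixes ys es)

Reducible : Fragment → Clause → Set
Reducible F C =
  ∃ λ b′ → b′ < ∣ C ∣ × Σ Clause λ C₁ → Σ Clause λ C₂ → (F ∞, b′) C₁ × (F ∞, b′) C₂ × SLDInfers C₁ C₂ C

Below : ℕ → ℕ → Lit → Set
Below K P l = All (_≤ K) (tvarsL l) × pv l < P

bounded : ∀ C → ∃₂ λ K P → All (Below K P) (lits C)
bounded C = K , suc P , All.zip (All-tvars⁻ (lits C) (xs≤max 0 (tvars C)) , All.map s≤s names≤P)
  where
  K = max 0 (tvars C)
  P = max 0 (List.map proj₁ (pvars C))
  names≤P : All (λ l → pv l ≤ P) (lits C)
  names≤P = map⁻ (map⁻ (xs≤max 0 (List.map proj₁ (pvars C))))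

-- The clause's term variables are ≤ K and its predicate names < P.  The hub takes the name P,
-- and shift moves the second premise to term variables > K and names > P.
module Reduction (K P : ℕ) where

  hub : Lit
  hub = lit K P (tabulate toℕ)

  shift : Subst
  shift = sub (suc K +_) (λ _ p → suc P + p)

  hub′ : Lit
  hub′ = substL shift hub

  ∈-hub : ∀ {x} → x ≤ K → x ∈ tvarsL hub
  ∈-hub x≤K =
    subst (_∈ tvarsL hub) (toℕ-fromℕ< (s≤s x≤K)) (∈-toList⁺ (∈-tabulate⁺ toℕ (fromℕ< (s≤s x≤K))))

  hub-vars : All (_≤ K) (tvarsL hub)
  hub-vars = VecAll.toList⁺ (VecAll.tabulate⁺ (λ i → s≤s⁻¹ (toℕ<n i)))

  hub-shares : ∀ l → All (_≤ K) (tvarsL l) → SharesVar hub l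
  hub-shares (lit _ _ (x ∷ _)) (x≤K ∷ _) = x , ∈-hub x≤K , here refl

  shift-vars : ∀ l → All (K <_) (tvarsL (substL shift l))
  shift-vars (lit _ _ xs) =
    subst (All (K <_)) (sym (toList-map (suc K +_) xs)) (map⁺ (All.universal (λ x → s≤s (m≤m+n K x)) _))

  HubUnifier : Subst → Set
  HubUnifier τ = (∀ x → x ≤ K → tσ τ x ≡ tσ τ (suc K + x)) × pσ τ K P ≡ pσ τ K (suc P + P)

  hub-args : ∀ (f : ℕ → ℕ) → Vec.map f (args hub) ≡ tabulate (f ∘ toℕ)
  hub-args f = sym (tabulate-∘ f toℕ)

  HubUnifier⇒Unifier : ∀ τ → HubUnifier τ → Unifier τ hub hub′
  HubUnifier⇒Unifier τ (vars , name) = cong₂ (lit K) name (begin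
    Vec.map (tσ τ) (args hub)                       ≡⟨ hub-args (tσ τ) ⟩
    tabulate (tσ τ ∘ toℕ)                           ≡⟨ tabulate-cong (λ i → vars (toℕ i) (s≤s⁻¹ (toℕ<n i))) ⟩
    tabulate (tσ τ ∘ (suc K +_) ∘ toℕ)              ≡⟨ hub-args (tσ τ ∘ (suc K +_)) ⟨
    Vec.map (tσ τ ∘ (suc K +_)) (args hub)          ≡⟨ map-∘ (tσ τ) (suc K +_) (args hub) ⟩
    Vec.map (tσ τ) (Vec.map (suc K +_) (args hub))  ∎)
    where open ≡-Reasoning

  Unifier⇒HubUnifier : ∀ τ → Unifier τ hub hub′ → HubUnifier τ
  Unifier⇒HubUnifier τ unifies = vars , cong pv unifies
    where
    sameArgs : tabulate (tσ τ ∘ toℕ) ≡ tabulate (tσ τ ∘ (suc K +_) ∘ toℕ)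
    sameArgs = begin
      tabulate (tσ τ ∘ toℕ)                           ≡⟨ hub-args (tσ τ) ⟨
      Vec.map (tσ τ) (args hub)                       ≡⟨ lit-injectiveʳ (trans unifies (substL-∘ τ shift hub)) ⟩
      Vec.map (tσ τ ∘ (suc K +_)) (args hub)          ≡⟨ hub-args (tσ τ ∘ (suc K +_)) ⟩
      tabulate (tσ τ ∘ (suc K +_) ∘ toℕ)              ∎
      where open ≡-Reasoning
    vars : ∀ x → x ≤ K → tσ τ x ≡ tσ τ (suc K + x)
    vars x x≤K = begin
      tσ τ x                                          ≡⟨ cong (tσ τ) x≡i ⟨
      tσ τ (toℕ i)                                    ≡⟨ lookup∘tabulate (tσ τ ∘ toℕ) i ⟨
      Vec.lookup (tabulate (tσ τ ∘ toℕ)) i            ≡⟨ cong (λ v → Vec.lookup v i) sameArgs ⟩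
      Vec.lookup (tabulate (tσ τ ∘ (suc K +_) ∘ toℕ)) i ≡⟨ lookup∘tabulate (tσ τ ∘ (suc K +_) ∘ toℕ) i ⟩
      tσ τ (suc K + toℕ i)                            ≡⟨ cong (λ y → tσ τ (suc K + y)) x≡i ⟩
      tσ τ (suc K + x)                                ∎
      where
      open ≡-Reasoning
      i = fromℕ< (s≤s x≤K)
      x≡i = toℕ-fromℕ< (s≤s x≤K)

  mergeVar : ℕ → ℕ
  mergeVar x with x ≤? K
  ... | yes _ = x
  ... | no _ with x ≤? suc K + K
  ...   | yes _ = x ∸ suc K
  ...   | no _  = x

  mergeName : ℕ → ℕ → ℕ
  mergeName a p with a ≟ K | p ≟ suc P + P
  ... | yes _ | yes _ = P
  ... | _     | _     = p

  merge : Subst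
  merge = sub mergeVar mergeName

  mergeVar-low : ∀ {x} → x ≤ K → mergeVar x ≡ x
  mergeVar-low {x} x≤K with x ≤? K
  ... | yes _   = refl
  ... | no x≰K  = ⊥-elim (x≰K x≤K)

  mergeVar-shifted : ∀ {x} → x ≤ K → mergeVar (suc K + x) ≡ x
  mergeVar-shifted {x} x≤K with suc K + x ≤? K
  ... | yes K<K+x = ⊥-elim (<⇒≱ (s≤s (m≤m+n K x)) K<K+x)
  ... | no _ with suc K + x ≤? suc K + K
  ...   | yes _    = m+n∸m≡n (suc K) x
  ...   | no x≰2K  = ⊥-elim (x≰2K (+-monoʳ-≤ (suc K) x≤K))

  mergeName-hub′ : mergeName K (suc P + P) ≡ P
  mergeName-hub′ with K ≟ K | suc P + P ≟ suc P + P
  ... | yes _ | yes _    = refl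
  ... | no K≢K | _       = ⊥-elim (K≢K refl)
  ... | yes _ | no ≢refl = ⊥-elim (≢refl refl)

  mergeName-fixes : ∀ a {p} → p ≢ suc P + P → mergeName a p ≡ p
  mergeName-fixes a {p} p≢ with a ≟ K | p ≟ suc P + P
  ... | yes _ | yes p≡ = ⊥-elim (p≢ p≡)
  ... | yes _ | no _   = refl
  ... | no _  | _      = refl

  ≤P⇒≢hubName : ∀ {p} → p ≤ P → p ≢ suc P + P
  ≤P⇒≢hubName p≤P = <⇒≢ (s≤s (≤-trans p≤P (m≤m+n P P)))

  merge-HubUnifier : HubUnifier merge
  merge-HubUnifier =
    (λ x x≤K → trans (mergeVar-low x≤K) (sym (mergeVar-shifted x≤K))) ,
    trans (mergeName-fixes K (≤P⇒≢hubName ≤-refl)) (sym mergeName-hub′)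

  HubUnifier⇒factors : ∀ τ → HubUnifier τ → τ ≗ˢ (τ ∘ˢ merge)
  HubUnifier⇒factors τ (vars , name) = onVars , onNames
    where
    onVars : ∀ x → tσ τ x ≡ tσ τ (mergeVar x)
    onVars x with x ≤? K
    ... | yes _ = refl
    ... | no x≰K with x ≤? suc K + K
    ...   | no _ = refl
    ...   | yes x≤2K = begin
      tσ τ x                       ≡⟨ cong (tσ τ) (m+[n∸m]≡n (≰⇒> x≰K)) ⟨
      tσ τ (suc K + (x ∸ suc K))   ≡⟨ vars (x ∸ suc K) (m≤n+o⇒m∸n≤o x (suc K) x≤2K) ⟨
      tσ τ (x ∸ suc K)             ∎
      where open ≡-Reasoning
    onNames : ∀ a p → pσ τ a p ≡ pσ τ a (mergeName a p)
    onNames a p with a ≟ K | p ≟ suc P + P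
    ... | yes refl | yes refl = sym name
    ... | yes _    | no _     = refl
    ... | no _     | _        = refl

  merge-mgu : MGU merge hub hub′
  merge-mgu =
    HubUnifier⇒Unifier merge merge-HubUnifier ,
    λ τ unifies → τ , HubUnifier⇒factors τ (Unifier⇒HubUnifier τ unifies)

  -- merge has already restored the term variables; unshift undoes shift on predicate names.
  unshiftName : ℕ → ℕ
  unshiftName p with p ≤? P
  ... | yes _ = p
  ... | no _  = p ∸ suc P

  unshift : Subst
  unshift = sub id (λ _ → unshiftName)

  unshiftName-low : ∀ {p} → p ≤ P → unshiftName p ≡ p
  unshiftName-low {p} p≤P with p ≤? P
  ... | yes _  = refl
  ... | no p≰P = ⊥-elim (p≰P p≤P)

  unshiftName-shifted : ∀ p → unshiftName (suc P + p) ≡ p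
  unshiftName-shifted p with suc P + p ≤? P
  ... | yes P<P+p = ⊥-elim (<⇒≱ (s≤s (m≤m+n P p)) P<P+p)
  ... | no _      = m+n∸m≡n (suc P) p

  restore : ∀ {l} → Below K P l → substL unshift (substL merge l) ≡ l
  restore {l} (vars , name<P) = trans (substL-∘ unshift merge l)
    (substL-fixes (unshift ∘ˢ merge) l (All.map mergeVar-low vars)
      (trans (cong unshiftName (mergeName-fixes (ar l) (≤P⇒≢hubName (<⇒≤ name<P))))
             (unshiftName-low (<⇒≤ name<P))))

  restore-shifted : ∀ {l} → Below K P l → substL unshift (substL merge (substL shift l)) ≡ l
  restore-shifted {l} (vars , name<P) = begin
    substL unshift (substL merge (substL shift l))  ≡⟨ cong (substL unshift) (substL-∘ merge shift l) ⟩
    substL unshift (substL (merge ∘ˢ shift) l)      ≡⟨ substL-∘ unshift (merge ∘ˢ shift) l ⟩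
    substL (unshift ∘ˢ (merge ∘ˢ shift)) l
      ≡⟨ substL-fixes (unshift ∘ˢ (merge ∘ˢ shift)) l (All.map mergeVar-shifted vars) name ⟩
    l                                               ∎
    where
    open ≡-Reasoning
    name : unshiftName (mergeName (ar l) (suc P + pv l)) ≡ pv l
    name = trans (cong unshiftName (mergeName-fixes (ar l) (<⇒≢ name<P ∘ +-cancelˡ-≡ (suc P) _ _)))
                 (unshiftName-shifted (pv l))

  front : Maybe Lit → Lit → Clause
  front hd l₁ = hd ⇐ (l₁ ∷ hub ∷ [])

  back : List Lit → Clause
  back rest = substC shift (just hub ⇐ rest)

  front-connected : ∀ hd l₁ → MaybeAll.All (Below K P) hd → Below K P l₁ → Connected (front hd l₁)
  front-connected hd l₁ hdB l₁B =
    shared⇒¬Disconnecting {hub} (lits (front hd l₁)) (∈-body⇒∈-lits (front hd l₁) (there (here refl)))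
      (All-lits⁺ (front hd l₁) (MaybeAll.map (λ {l} below → hub-shares l (proj₁ below)) hdB)
        (hub-shares l₁ (proj₁ l₁B) ∷ SharesVar-refl hub ∷ []))

  back-connected : ∀ rest → All (Below K P) rest → Connected (back rest)
  back-connected rest restB = shared⇒¬Disconnecting {hub′} (lits (back rest)) (here refl)
    (map⁺ {f = substL shift} (All.map (λ {l} → SharesVar-substL shift hub {l})
      (SharesVar-refl hub ∷ All.map (λ {l} below → hub-shares l (proj₁ below)) restB)))

  front-back-apart : ∀ hd l₁ rest → MaybeAll.All (Below K P) hd → Below K P l₁ →
                     Apart (front hd l₁) (back rest)
  front-back-apart hd l₁ rest hdB l₁B = separated⇒Apart (front hd l₁) (back rest)
    (All-tvars⁺ (lits (front hd l₁))
      (All-lits⁺ (front hd l₁) (MaybeAll.map proj₁ hdB) (proj₁ l₁B ∷ hub-vars ∷ [])))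
    (All-tvars⁺ (lits (back rest)) (map⁺ (All.universal shift-vars (hub ∷ rest))))
    (map⁺ (All-lits⁺ (front hd l₁) (MaybeAll.map (<⇒≤ ∘ proj₂) hdB) (<⇒≤ (proj₂ l₁B) ∷ ≤-refl ∷ [])))
    (map⁺ (map⁺ (All.universal (λ l → s≤s (m≤m+n P (pv l))) (hub ∷ rest))))

  front-back-infers : ∀ hd l₁ rest → MaybeAll.All (Below K P) hd → Below K P l₁ → All (Below K P) rest →
                      SLDInfers (front hd l₁) (back rest) (hd ⇐ (l₁ ∷ rest))
  front-back-infers hd l₁ rest hdB l₁B restB =
    substC merge (hd ⇐ (l₁ ∷ body (back rest))) ,
    (front-back-apart hd l₁ rest hdB l₁B , suc zero , hub′ , merge , refl , merge-mgu , refl) ,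
    unshift , restoreHead hdB , ↭-reflexive (cong₂ _∷_ (restore l₁B) (restoreRest restB))
    where
    restoreHead : ∀ {hd} → MaybeAll.All (Below K P) hd →
                  Maybe.map (substL unshift) (Maybe.map (substL merge) hd) ≡ hd
    restoreHead nothing  = refl
    restoreHead (just b) = cong just (restore b)
    restoreRest : ∀ {ls} → All (Below K P) ls →
                  List.map (substL unshift) (List.map (substL merge) (List.map (substL shift) ls)) ≡ ls
    restoreRest []       = refl
    restoreRest (b ∷ bs) = cong₂ _∷_ (restore-shifted b) (restoreRest bs)

  reducible : ∀ hd l₁ rest → All (Below K P) (lits (hd ⇐ (l₁ ∷ rest))) → 2 ≤ length rest →
              Reducible Hc (hd ⇐ (l₁ ∷ rest))
  reducible hd l₁ rest below 2≤|rest| with All-lits⁻ (hd ⇐ (l₁ ∷ rest)) below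
  ... | hdB , l₁B ∷ restB =
    length rest , n<1+n (length rest) , front hd l₁ , back rest ,
    (front-connected hd l₁ hdB l₁B , 2≤|rest|) ,
    (back-connected rest restB , ≤-reflexive (length-map (substL shift) rest)) ,
    front-back-infers hd l₁ rest hdB l₁B restB

mainTheorem5 : ReducibleTo Hc 2
mainTheorem5 (_ ⇐ [])             _ ()
mainTheorem5 C@(hd ⇐ (l₁ ∷ rest)) _ (s≤s 2≤|rest|) =
  let K , P , below = bounded C in Reduction.reducible K P hd l₁ rest below 2≤|rest|
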